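{- Let $n\geqslant 5$ and let $\phi$ be an automorphism of $\text{CQ}_{n+2}$. Identify each vertex of a crossed cube with the integer whose binary representation is its address. Then the map $\hat{\phi}:V(\text{CQ}_n)\to V(\text{CQ}_n)$ defined by $\hat{\phi}(v)=\lfloor \phi(4v)/4\rfloor$ is an automorphism of $\text{CQ}_n$.
   Context: Two 2-bit strings $x_2x_1$ and $y_2y_1$ are pair related, written $x_2x_1\sim y_2y_1$, iff $(x_2x_1,y_2y_1)\in\{(00,00),(10,10),(01,11),(11,01)\}$. The $m$-dimensional crossed cube $\text{CQ}_m$ has as vertices all binary strings $u=u_{m-1}\ldots u_0$ of length $m$ (identified with the integer $\sum_i u_i2^i$). Two vertices $u,v$ are adjacent iff there is an index $x$ with $0\leqslant x\leqslant m-1$ such that: (1) $v_x\neq u_x$; (2) if $x$ is odd, $v_{x-1}=u_{x-1}$; (3) $v_i=u_i$ for all $i>x$; (4) $u_{2i+1}u_{2i}\sim v_{2i+1}v_{2i}$ for all $0\leqslant i\leqslant\lfloor x/2\rfloor-1$. -}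

module Defs where

open import Data.Nat using (ℕ; zero; suc; _+_; _*_; _^_; _∸_; _<_; _≤_; NonZero)
open import Data.Nat.DivMod using (_/_; _%_; m<n*o⇒m/o<n)
open import Data.Nat.Properties using (*-comm; *-monoʳ-<; ^-distribˡ-+-*)
open import Data.Fin using (Fin; toℕ; fromℕ<)
open import Data.Fin.Properties using (toℕ<n)
open import Data.Product using (Σ; _×_; _,_; ∃-syntax)
open import Data.Sum using (_⊎_)
open import Relation.Binary.PropositionalEquality using (_≡_; _≢_; subst; sym)
open import Relation.Nullary using (¬_)
open import Function.Bundles using (_⇔_)
open import Function.Definitions using (Bijective)

bit : ℕ → ℕ → ℕ
bit u zero    = u % 2
bit u (suc i) = bit (u / 2) i

PairRel : ℕ → ℕ → ℕ → ℕ → Set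
PairRel x2 x1 y2 y1 =
    (x2 ≡ 0 × x1 ≡ 0 × y2 ≡ 0 × y1 ≡ 0)
  ⊎ (x2 ≡ 1 × x1 ≡ 0 × y2 ≡ 1 × y1 ≡ 0)
  ⊎ (x2 ≡ 0 × x1 ≡ 1 × y2 ≡ 1 × y1 ≡ 1)
  ⊎ (x2 ≡ 1 × x1 ≡ 1 × y2 ≡ 0 × y1 ≡ 1)

Vertex : ℕ → Set
Vertex m = Fin (2 ^ m)

Adj : (m : ℕ) → Vertex m → Vertex m → Set
Adj m u' v' =
  let u = toℕ u' ; v = toℕ v' in
  ∃[ x ] (x < m
    × bit v x ≢ bit u x
    × (x % 2 ≡ 1 → bit v (x ∸ 1) ≡ bit u (x ∸ 1))
    × (∀ i → x < i → i < m → bit v i ≡ bit u i)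
    × (∀ i → i < x / 2 →
         PairRel (bit u (suc (2 * i))) (bit u (2 * i))
                 (bit v (suc (2 * i))) (bit v (2 * i))))

IsAutomorphism : (m : ℕ) → (Vertex m → Vertex m) → Set
IsAutomorphism m f =
  Bijective {A = Vertex m} _≡_ _≡_ f
  × (∀ u v → Adj m u v ⇔ Adj m (f u) (f v))

4v<2^[n+2] : ∀ n (v : Vertex n) → 4 * toℕ v < 2 ^ (n + 2)
4v<2^[n+2] n v = subst (4 * toℕ v <_) (sym (2^[n+2] n)) (*-monoʳ-< 4 (toℕ<n v))
  where
  2^[n+2] : ∀ n → 2 ^ (n + 2) ≡ 4 * 2 ^ n
  2^[n+2] n rewrite ^-distribˡ-+-* 2 n 2 = *-comm (2 ^ n) 4

times4 : ∀ n → Vertex n → Vertex (n + 2)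
times4 n v = fromℕ< (4v<2^[n+2] n v)

div4 : ∀ n → Vertex (n + 2) → Vertex n
div4 n w = fromℕ< (m<n*o⇒m/o<n {n = 2 ^ n} {o = 4}
  (subst (toℕ w <_) (^-distribˡ-+-* 2 n 2) (toℕ<n w)))

hat : ∀ n → (Vertex (n + 2) → Vertex (n + 2)) → Vertex n → Vertex n
hat n φ v = div4 n (φ (times4 n v))

-- Write a vertex of CQ_(n+2) as 4y + p with p < 4, so that its block {4y, …, 4y + 3} is a copy of
-- the 4-cycle CQ_2. Edges flipping bit 0 or bit 1 stay inside a block, and every other edge joins
-- 4y + p to 4y' + partner p, where y ~ y' in CQ_n and partner p is the unique 2-bit string pair
-- related to p. For n ≥ 2, every edge flipping bit 1 and every edge between blocks lies on two
-- 4-cycles that differ in the vertex opposite to the first endpoint, while a 4-cycle through a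
-- bit-0 edge must continue along the bit-1 edge of the same block. Automorphisms preserve this
-- property of edges, so they map bit-0 edges to bit-0 edges, then (via the block 4-cycle) bit-1
-- edges to bit-1 edges, hence blocks to blocks. The induced map on blocks is v ↦ ⌊φ(4v)/4⌋; the
-- one induced by φ⁻¹ inverts it, and edges between blocks are mapped to edges between blocks.
module Submission where

open import Defs
open import Data.Nat using (ℕ; zero; suc; _+_; _*_; _^_; _∸_; _<_; _≤_; z≤n; s≤s; z<s; s<s; s<s⁻¹)
open import Data.Nat.DivMod
open import Data.Nat.Divisibility using (divides)
open import Data.Nat.Properties
open import Data.Fin using (toℕ; fromℕ<)
open import Data.Fin.Properties using (toℕ<n; toℕ-fromℕ<; toℕ-injective)
open import Data.Product using (_×_; _,_; ∃-syntax; proj₁; proj₂)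
open import Data.Sum using (_⊎_; inj₁; inj₂)
open import Data.Empty using (⊥-elim)
open import Relation.Binary.PropositionalEquality
open import Relation.Nullary using (¬_)
open import Function using (id; _∘_)
open import Function.Bundles using (mk⇔; Equivalence)
open import Function.Definitions using (Injective; Bijective)
open import Function.Consequences using (inverseᵇ⇒bijective)
open import Function.Consequences.Propositional using (strictlyInverseˡ⇒inverseˡ; strictlyInverseʳ⇒inverseʳ)

strictlyInverseᵇ⇒bijective : ∀ {A B : Set} {f : A → B} (g : B → A) →
  (∀ y → f (g y) ≡ y) → (∀ x → g (f x) ≡ x) → Bijective _≡_ _≡_ f
strictlyInverseᵇ⇒bijective {f = f} g fg gf =
  inverseᵇ⇒bijective {f⁻¹ = g} _≡_ refl sym trans
    (strictlyInverseˡ⇒inverseˡ {f⁻¹ = g} f fg , strictlyInverseʳ⇒inverseʳ {f⁻¹ = g} f gf)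

module _ {V : Set} (E : V → V → Set) where

  Square : V → V → V → V → Set
  Square u v w z = E u v × E v w × E w z × E z u × u ≢ w × v ≢ z

  OnSquare : V → V → Set
  OnSquare u v = ∃[ w ] ∃[ z ] Square u v w z

  OnTwoSquares : V → V → Set
  OnTwoSquares u v = ∃[ w ] ∃[ z ] ∃[ w′ ] ∃[ z′ ] (Square u v w z × Square u v w′ z′ × w ≢ w′)

  square-reverse : (∀ {a b} → E a b → E b a) → ∀ {u v w z} → Square u v w z → Square u z w v
  square-reverse E-sym (uv , vw , wz , zu , u≢w , v≢z) = E-sym zu , E-sym wz , E-sym vw , E-sym uv , u≢w , v≢z ∘ sym

  square-rotate : ∀ {u v w z} → Square u v w z → Square z u v w
  square-rotate (uv , vw , wz , zu , u≢w , v≢z) = zu , uv , vw , wz , v≢z ∘ sym , u≢w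

  module _ {f : V → V} (hom : ∀ {a b} → E a b → E (f a) (f b)) (inj : Injective _≡_ _≡_ f) where

    square-map : ∀ {u v w z} → Square u v w z → Square (f u) (f v) (f w) (f z)
    square-map (uv , vw , wz , zu , u≢w , v≢z) = hom uv , hom vw , hom wz , hom zu , u≢w ∘ inj , v≢z ∘ inj

    onTwoSquares-map : ∀ {u v} → OnTwoSquares u v → OnTwoSquares (f u) (f v)
    onTwoSquares-map (w , z , w′ , z′ , sq , sq′ , w≢w′) =
      f w , f z , f w′ , f z′ , square-map sq , square-map sq′ , w≢w′ ∘ inj

PairRel-sym : ∀ {a b c d} → PairRel a b c d → PairRel c d a b
PairRel-sym (inj₁ (e₁ , e₂ , e₃ , e₄)) = inj₁ (e₃ , e₄ , e₁ , e₂)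
PairRel-sym (inj₂ (inj₁ (e₁ , e₂ , e₃ , e₄))) = inj₂ (inj₁ (e₃ , e₄ , e₁ , e₂))
PairRel-sym (inj₂ (inj₂ (inj₁ (e₁ , e₂ , e₃ , e₄)))) = inj₂ (inj₂ (inj₂ (e₃ , e₄ , e₁ , e₂)))
PairRel-sym (inj₂ (inj₂ (inj₂ (e₁ , e₂ , e₃ , e₄)))) = inj₂ (inj₂ (inj₁ (e₃ , e₄ , e₁ , e₂)))

PairRel-cong : ∀ {a a′ b b′ c c′ d d′} → a ≡ a′ → b ≡ b′ → c ≡ c′ → d ≡ d′ → PairRel a b c d ≡ PairRel a′ b′ c′ d′
PairRel-cong refl refl refl refl = refl

PairedAt : ℕ → ℕ → ℕ → Set
PairedAt a b i = PairRel (bit a (suc (2 * i))) (bit a (2 * i)) (bit b (suc (2 * i))) (bit b (2 * i))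

Adj-sym : ∀ {m u v} → Adj m u v → Adj m v u
Adj-sym (x , x<m , differ , parity , above , paired) =
  x , x<m , differ ∘ sym , sym ∘ parity , (λ i x<i i<m → sym (above i x<i i<m)) , (λ i i< → PairRel-sym (paired i i<))

Adj⇒≢ : ∀ {m u v} → Adj m u v → u ≢ v
Adj⇒≢ (_ , _ , differ , _) refl = differ refl

HasNeighbours : ℕ → Set
HasNeighbours m = (y : Vertex m) → ∃[ y′ ] Adj m y y′

EdgesOnSquares : ℕ → Set
EdgesOnSquares m = ∀ {y y′ : Vertex m} → Adj m y y′ → OnSquare (Adj m) y y′

module _ {m : ℕ} {φ : Vertex m → Vertex m} (aut : IsAutomorphism m φ) where

  inverse : Vertex m → Vertex m
  inverse w = proj₁ (proj₂ (proj₁ aut) w)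

  inverseˡ : ∀ w → φ (inverse w) ≡ w
  inverseˡ w = proj₂ (proj₂ (proj₁ aut) w) refl

  inverseʳ : ∀ u → inverse (φ u) ≡ u
  inverseʳ u = proj₁ (proj₁ aut) (inverseˡ (φ u))

  preserves-adj : ∀ {u v} → Adj m u v → Adj m (φ u) (φ v)
  preserves-adj {u} {v} = Equivalence.to (proj₂ aut u v)

  inverse-isAutomorphism : IsAutomorphism m inverse
  inverse-isAutomorphism =
    strictlyInverseᵇ⇒bijective φ inverseʳ inverseˡ ,
    λ u v → mk⇔ (λ uv → Equivalence.from (proj₂ aut (inverse u) (inverse v)) (subst₂ (Adj m) (sym (inverseˡ u)) (sym (inverseˡ v)) uv))
                (λ uv → subst₂ (Adj m) (inverseˡ u) (inverseˡ v) (preserves-adj uv))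

  onTwoSquares-reflect : ∀ {u v} → OnTwoSquares (Adj m) (φ u) (φ v) → OnTwoSquares (Adj m) u v
  onTwoSquares-reflect {u} {v} =
    subst₂ (OnTwoSquares (Adj m)) (inverseʳ u) (inverseʳ v)
    ∘ onTwoSquares-map (Adj m) (Equivalence.to (proj₂ inverse-isAutomorphism _ _)) (proj₁ (proj₁ inverse-isAutomorphism))

bits-injective : ∀ k {a b} → a < 2 ^ k → b < 2 ^ k → (∀ i → i < k → bit a i ≡ bit b i) → a ≡ b
bits-injective zero a<1 b<1 _ = trans (n<1⇒n≡0 a<1) (sym (n<1⇒n≡0 b<1))
bits-injective (suc k) {a} {b} a< b< same = begin
  a                  ≡⟨ m≡m%n+[m/n]*n a 2 ⟩
  a % 2 + a / 2 * 2  ≡⟨ cong₂ (λ r q → r + q * 2) (same 0 z<s) halves ⟩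
  b % 2 + b / 2 * 2  ≡⟨ m≡m%n+[m/n]*n b 2 ⟨
  b                  ∎
  where
  open ≡-Reasoning
  half< : ∀ {c} → c < 2 ^ suc k → c / 2 < 2 ^ k
  half< {c} c< = m<n*o⇒m/o<n (subst (c <_) (*-comm 2 (2 ^ k)) c<)
  halves : a / 2 ≡ b / 2
  halves = bits-injective k (half< a<) (half< b<) (λ i i<k → same (suc i) (s≤s i<k))

m<n⇒2+m<n+2 : ∀ {m n} → m < n → 2 + m < n + 2
m<n⇒2+m<n+2 {m} {n} m<n = subst (2 + m <_) (+-comm 2 n) (s≤s (s≤s m<n))

2+m<n+2⇒m<n : ∀ {m n} → 2 + m < n + 2 → m < n
2+m<n+2⇒m<n {m} {n} lt with subst (2 + m <_) (+-comm n 2) lt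
... | s≤s (s≤s m<n) = m<n

m<2⇒m<n+2 : ∀ {m} n → m < 2 → m < n + 2
m<2⇒m<n+2 n m<2 = <-≤-trans m<2 (m≤n+m 2 n)

[2+m]/2≡1+m/2 : ∀ m → (2 + m) / 2 ≡ 1 + m / 2
[2+m]/2≡1+m/2 m = m/n≡1+[m∸n]/n {2 + m} {2} (s≤s (s≤s z≤n))

data Low : Set where
  l0 l1 l2 l3 : Low

lowValue : Low → ℕ
lowValue l0 = 0
lowValue l1 = 1
lowValue l2 = 2
lowValue l3 = 3

toLow : ℕ → Low
toLow 0 = l0
toLow 1 = l1
toLow 2 = l2
toLow _ = l3

bit₀ bit₁ : Low → ℕ
bit₀ p = bit (lowValue p) 0
bit₁ p = bit (lowValue p) 1

fromBits : ℕ → ℕ → Low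
fromBits 0 0 = l0
fromBits 0 _ = l1
fromBits _ 0 = l2
fromBits _ _ = l3

flip₀ flip₁ partner : Low → Low
flip₀ l0 = l1
flip₀ l1 = l0
flip₀ l2 = l3
flip₀ l3 = l2
flip₁ l0 = l2
flip₁ l1 = l3
flip₁ l2 = l0
flip₁ l3 = l1
partner l0 = l0
partner l1 = l3
partner l2 = l2
partner l3 = l1

lowValue<4 : ∀ p → lowValue p < 4
lowValue<4 l0 = s≤s z≤n
lowValue<4 l1 = s≤s (s≤s z≤n)
lowValue<4 l2 = s≤s (s≤s (s≤s z≤n))
lowValue<4 l3 = s≤s (s≤s (s≤s (s≤s z≤n)))

lowValue-toLow : ∀ {r} → r < 4 → lowValue (toLow r) ≡ r
lowValue-toLow {0} _ = refl
lowValue-toLow {1} _ = refl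
lowValue-toLow {2} _ = refl
lowValue-toLow {3} _ = refl
lowValue-toLow {suc (suc (suc (suc _)))} (s≤s (s≤s (s≤s (s≤s ()))))

toLow-lowValue : ∀ p → toLow (lowValue p) ≡ p
toLow-lowValue l0 = refl
toLow-lowValue l1 = refl
toLow-lowValue l2 = refl
toLow-lowValue l3 = refl

fromBits-bits : ∀ p → fromBits (bit₁ p) (bit₀ p) ≡ p
fromBits-bits l0 = refl
fromBits-bits l1 = refl
fromBits-bits l2 = refl
fromBits-bits l3 = refl

paired⇒partner : ∀ {a b c d} → PairRel a b c d → fromBits c d ≡ partner (fromBits a b)
paired⇒partner (inj₁ (refl , refl , refl , refl)) = refl
paired⇒partner (inj₂ (inj₁ (refl , refl , refl , refl))) = refl
paired⇒partner (inj₂ (inj₂ (inj₁ (refl , refl , refl , refl)))) = refl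
paired⇒partner (inj₂ (inj₂ (inj₂ (refl , refl , refl , refl)))) = refl

partner-unique : ∀ p q → PairRel (bit₁ p) (bit₀ p) (bit₁ q) (bit₀ q) → q ≡ partner p
partner-unique p q r = begin
  q                                    ≡⟨ fromBits-bits q ⟨
  fromBits (bit₁ q) (bit₀ q)           ≡⟨ paired⇒partner r ⟩
  partner (fromBits (bit₁ p) (bit₀ p)) ≡⟨ cong partner (fromBits-bits p) ⟩
  partner p                            ∎
  where open ≡-Reasoning

partner-paired : ∀ p → PairRel (bit₁ p) (bit₀ p) (bit₁ (partner p)) (bit₀ (partner p))
partner-paired l0 = inj₁ (refl , refl , refl , refl)
partner-paired l1 = inj₂ (inj₂ (inj₁ (refl , refl , refl , refl)))
partner-paired l2 = inj₂ (inj₁ (refl , refl , refl , refl))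
partner-paired l3 = inj₂ (inj₂ (inj₂ (refl , refl , refl , refl)))

bit₀-flip₀ : ∀ p → bit₀ (flip₀ p) ≢ bit₀ p
bit₀-flip₀ l0 ()
bit₀-flip₀ l1 ()
bit₀-flip₀ l2 ()
bit₀-flip₀ l3 ()

bit₁-flip₀ : ∀ p → bit₁ (flip₀ p) ≡ bit₁ p
bit₁-flip₀ l0 = refl
bit₁-flip₀ l1 = refl
bit₁-flip₀ l2 = refl
bit₁-flip₀ l3 = refl

bit₁-flip₁ : ∀ p → bit₁ (flip₁ p) ≢ bit₁ p
bit₁-flip₁ l0 ()
bit₁-flip₁ l1 ()
bit₁-flip₁ l2 ()
bit₁-flip₁ l3 ()

bit₀-flip₁ : ∀ p → bit₀ (flip₁ p) ≡ bit₀ p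
bit₀-flip₁ l0 = refl
bit₀-flip₁ l1 = refl
bit₀-flip₁ l2 = refl
bit₀-flip₁ l3 = refl

flip₀-unique : ∀ p q → bit₀ q ≢ bit₀ p → bit₁ q ≡ bit₁ p → q ≡ flip₀ p
flip₀-unique l0 l0 d _ = ⊥-elim (d refl)
flip₀-unique l0 l1 _ _ = refl
flip₀-unique l0 l2 d _ = ⊥-elim (d refl)
flip₀-unique l0 l3 _ ()
flip₀-unique l1 l0 _ _ = refl
flip₀-unique l1 l1 d _ = ⊥-elim (d refl)
flip₀-unique l1 l2 _ ()
flip₀-unique l1 l3 d _ = ⊥-elim (d refl)
flip₀-unique l2 l0 d _ = ⊥-elim (d refl)
flip₀-unique l2 l1 _ ()
flip₀-unique l2 l2 d _ = ⊥-elim (d refl)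
flip₀-unique l2 l3 _ _ = refl
flip₀-unique l3 l0 _ ()
flip₀-unique l3 l1 d _ = ⊥-elim (d refl)
flip₀-unique l3 l2 _ _ = refl
flip₀-unique l3 l3 d _ = ⊥-elim (d refl)

flip₁-unique : ∀ p q → bit₁ q ≢ bit₁ p → bit₀ q ≡ bit₀ p → q ≡ flip₁ p
flip₁-unique l0 l0 d _ = ⊥-elim (d refl)
flip₁-unique l0 l1 d _ = ⊥-elim (d refl)
flip₁-unique l0 l2 _ _ = refl
flip₁-unique l0 l3 _ ()
flip₁-unique l1 l0 d _ = ⊥-elim (d refl)
flip₁-unique l1 l1 d _ = ⊥-elim (d refl)
flip₁-unique l1 l2 _ ()
flip₁-unique l1 l3 _ _ = refl
flip₁-unique l2 l0 _ _ = refl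
flip₁-unique l2 l1 _ ()
flip₁-unique l2 l2 d _ = ⊥-elim (d refl)
flip₁-unique l2 l3 d _ = ⊥-elim (d refl)
flip₁-unique l3 l0 _ ()
flip₁-unique l3 l1 _ _ = refl
flip₁-unique l3 l2 d _ = ⊥-elim (d refl)
flip₁-unique l3 l3 d _ = ⊥-elim (d refl)

flip₀-involutive : ∀ p → flip₀ (flip₀ p) ≡ p
flip₀-involutive l0 = refl
flip₀-involutive l1 = refl
flip₀-involutive l2 = refl
flip₀-involutive l3 = refl

flip₁-involutive : ∀ p → flip₁ (flip₁ p) ≡ p
flip₁-involutive l0 = refl
flip₁-involutive l1 = refl
flip₁-involutive l2 = refl
flip₁-involutive l3 = refl

partner-involutive : ∀ p → partner (partner p) ≡ p
partner-involutive l0 = refl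
partner-involutive l1 = refl
partner-involutive l2 = refl
partner-involutive l3 = refl

flip₀-flip₁-comm : ∀ p → flip₀ (flip₁ p) ≡ flip₁ (flip₀ p)
flip₀-flip₁-comm l0 = refl
flip₀-flip₁-comm l1 = refl
flip₀-flip₁-comm l2 = refl
flip₀-flip₁-comm l3 = refl

partner-flip₁-comm : ∀ p → partner (flip₁ p) ≡ flip₁ (partner p)
partner-flip₁-comm l0 = refl
partner-flip₁-comm l1 = refl
partner-flip₁-comm l2 = refl
partner-flip₁-comm l3 = refl

flip₀≢flip₁ : ∀ p → flip₀ p ≢ flip₁ p
flip₀≢flip₁ l0 ()
flip₀≢flip₁ l1 ()
flip₀≢flip₁ l2 ()
flip₀≢flip₁ l3 ()

flip₁-flip₀≢id : ∀ p → flip₁ (flip₀ p) ≢ p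
flip₁-flip₀≢id l0 ()
flip₁-flip₀≢id l1 ()
flip₁-flip₀≢id l2 ()
flip₁-flip₀≢id l3 ()

flip₀-partner-partner-flip₁-not-closed : ∀ p → flip₁ (partner (partner (flip₀ p))) ≢ p
flip₀-partner-partner-flip₁-not-closed l0 ()
flip₀-partner-partner-flip₁-not-closed l1 ()
flip₀-partner-partner-flip₁-not-closed l2 ()
flip₀-partner-partner-flip₁-not-closed l3 ()

flip₀-partner-flip₀-partner-not-closed : ∀ p → partner (flip₀ (partner (flip₀ p))) ≢ p
flip₀-partner-flip₀-partner-not-closed l0 ()
flip₀-partner-flip₀-partner-not-closed l1 ()
flip₀-partner-flip₀-partner-not-closed l2 ()
flip₀-partner-flip₀-partner-not-closed l3 ()

flip₀-partner-flip₁-partner-not-closed : ∀ p → partner (flip₁ (partner (flip₀ p))) ≢ p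
flip₀-partner-flip₁-partner-not-closed l0 ()
flip₀-partner-flip₁-partner-not-closed l1 ()
flip₀-partner-flip₁-partner-not-closed l2 ()
flip₀-partner-flip₁-partner-not-closed l3 ()

flip₀-partner-partner-partner-not-closed : ∀ p → partner (partner (partner (flip₀ p))) ≢ p
flip₀-partner-partner-partner-not-closed l0 ()
flip₀-partner-partner-partner-not-closed l1 ()
flip₀-partner-partner-partner-not-closed l2 ()
flip₀-partner-partner-partner-not-closed l3 ()

within-block : ∀ p q → q ≡ p ⊎ q ≡ flip₀ p ⊎ q ≡ flip₁ p ⊎ q ≡ flip₁ (flip₀ p)
within-block l0 l0 = inj₁ refl
within-block l0 l1 = inj₂ (inj₁ refl)
within-block l0 l2 = inj₂ (inj₂ (inj₁ refl))
within-block l0 l3 = inj₂ (inj₂ (inj₂ refl))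
within-block l1 l0 = inj₂ (inj₁ refl)
within-block l1 l1 = inj₁ refl
within-block l1 l2 = inj₂ (inj₂ (inj₂ refl))
within-block l1 l3 = inj₂ (inj₂ (inj₁ refl))
within-block l2 l0 = inj₂ (inj₂ (inj₁ refl))
within-block l2 l1 = inj₂ (inj₂ (inj₂ refl))
within-block l2 l2 = inj₁ refl
within-block l2 l3 = inj₂ (inj₁ refl)
within-block l3 l0 = inj₂ (inj₂ (inj₂ refl))
within-block l3 l1 = inj₂ (inj₂ (inj₁ refl))
within-block l3 l2 = inj₂ (inj₁ refl)
within-block l3 l3 = inj₁ refl

address : Low → ℕ → ℕ
address p y = lowValue p + y * 4

address%4 : ∀ p y → address p y % 4 ≡ lowValue p
address%4 p y = trans ([m+kn]%n≡m%n (lowValue p) y 4) (m<n⇒m%n≡m (lowValue<4 p))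

address/4 : ∀ p y → address p y / 4 ≡ y
address/4 p y = begin
  (lowValue p + y * 4) / 4     ≡⟨ +-distrib-/-∣ʳ (lowValue p) (divides y refl) ⟩
  lowValue p / 4 + y * 4 / 4   ≡⟨ cong₂ _+_ (m<n⇒m/n≡0 (lowValue<4 p)) (m*n/n≡m y 4) ⟩
  y                            ∎
  where open ≡-Reasoning

address/2 : ∀ p y → address p y / 2 ≡ lowValue p / 2 + y * 2
address/2 p y = begin
  (lowValue p + y * 4) / 2         ≡⟨ cong (λ t → (lowValue p + t) / 2) (sym (*-assoc y 2 2)) ⟩
  (lowValue p + y * 2 * 2) / 2     ≡⟨ +-distrib-/-∣ʳ (lowValue p) (divides (y * 2) refl) ⟩
  lowValue p / 2 + y * 2 * 2 / 2   ≡⟨ cong (lowValue p / 2 +_) (m*n/n≡m (y * 2) 2) ⟩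
  lowValue p / 2 + y * 2           ∎
  where open ≡-Reasoning

bit₀-address : ∀ p y → bit (address p y) 0 ≡ bit₀ p
bit₀-address p y = begin
  (lowValue p + y * 4) % 2      ≡⟨ cong (λ t → (lowValue p + t) % 2) (sym (*-assoc y 2 2)) ⟩
  (lowValue p + y * 2 * 2) % 2  ≡⟨ [m+kn]%n≡m%n (lowValue p) (y * 2) 2 ⟩
  lowValue p % 2                ∎
  where open ≡-Reasoning

bit₁-address : ∀ p y → bit (address p y) 1 ≡ bit₁ p
bit₁-address p y = trans (cong (_% 2) (address/2 p y)) ([m+kn]%n≡m%n (lowValue p / 2) y 2)

bit-address : ∀ p y i → bit (address p y) (2 + i) ≡ bit y i
bit-address p y i = cong (λ t → bit t i) (trans (m/n/o≡m/[n*o] (address p y) 2 2) (address/4 p y))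

module _ (n : ℕ) where

  V : Set
  V = Vertex (n + 2)

  address<2^[n+2] : ∀ p (y : Vertex n) → address p (toℕ y) < 2 ^ (n + 2)
  address<2^[n+2] p y = subst (address p (toℕ y) <_) (sym (^-distribˡ-+-* 2 n 2)) (begin-strict
    lowValue p + toℕ y * 4  <⟨ +-monoˡ-< (toℕ y * 4) (lowValue<4 p) ⟩
    suc (toℕ y) * 4         ≤⟨ *-monoˡ-≤ 4 (toℕ<n y) ⟩
    2 ^ n * 4               ∎)
    where open ≤-Reasoning

  lo : V → Low
  lo u = toLow (toℕ u % 4)

  hi : V → Vertex n
  hi = div4 n

  join : Low → Vertex n → V
  join p y = fromℕ< (address<2^[n+2] p y)

  toℕ-join : ∀ p y → toℕ (join p y) ≡ address p (toℕ y)
  toℕ-join p y = toℕ-fromℕ< (address<2^[n+2] p y)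

  toℕ-hi : ∀ u → toℕ (hi u) ≡ toℕ u / 4
  toℕ-hi u = toℕ-fromℕ< _

  toℕ≡address : ∀ u → toℕ u ≡ address (lo u) (toℕ (hi u))
  toℕ≡address u = begin
    toℕ u                       ≡⟨ m≡m%n+[m/n]*n (toℕ u) 4 ⟩
    toℕ u % 4 + toℕ u / 4 * 4   ≡⟨ cong₂ (λ r q → r + q * 4) (sym (lowValue-toLow (m%n<n (toℕ u) 4))) (sym (toℕ-hi u)) ⟩
    address (lo u) (toℕ (hi u)) ∎
    where open ≡-Reasoning

  lo-join : ∀ p y → lo (join p y) ≡ p
  lo-join p y = trans (cong (λ a → toLow (a % 4)) (toℕ-join p y))
                      (trans (cong toLow (address%4 p (toℕ y))) (toLow-lowValue p))

  hi-join : ∀ p y → hi (join p y) ≡ y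
  hi-join p y = toℕ-injective (trans (toℕ-hi (join p y)) (trans (cong (_/ 4) (toℕ-join p y)) (address/4 p (toℕ y))))

  join-lo-hi : ∀ u → join (lo u) (hi u) ≡ u
  join-lo-hi u = toℕ-injective (trans (toℕ-join (lo u) (hi u)) (sym (toℕ≡address u)))

  lo-hi-injective : ∀ {u v} → lo u ≡ lo v → hi u ≡ hi v → u ≡ v
  lo-hi-injective {u} {v} l h = trans (sym (join-lo-hi u)) (trans (cong₂ join l h) (join-lo-hi v))

  bit-lo₀ : ∀ u → bit (toℕ u) 0 ≡ bit₀ (lo u)
  bit-lo₀ u = trans (cong (λ a → bit a 0) (toℕ≡address u)) (bit₀-address (lo u) (toℕ (hi u)))

  bit-lo₁ : ∀ u → bit (toℕ u) 1 ≡ bit₁ (lo u)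
  bit-lo₁ u = trans (cong (λ a → bit a 1) (toℕ≡address u)) (bit₁-address (lo u) (toℕ (hi u)))

  bit-hi : ∀ u i → bit (toℕ u) (2 + i) ≡ bit (toℕ (hi u)) i
  bit-hi u i = trans (cong (λ a → bit a (2 + i)) (toℕ≡address u)) (bit-address (lo u) (toℕ (hi u)) i)

  high-bits-agree : ∀ {u v} → hi v ≡ hi u → ∀ i → bit (toℕ v) (2 + i) ≡ bit (toℕ u) (2 + i)
  high-bits-agree {u} {v} h i = trans (bit-hi v i) (trans (cong (λ y → bit (toℕ y) i) h) (sym (bit-hi u i)))

  hi-from-bits : ∀ {u v} → (∀ i → i < n → bit (toℕ v) (2 + i) ≡ bit (toℕ u) (2 + i)) → hi v ≡ hi u
  hi-from-bits {u} {v} same = toℕ-injective (bits-injective n (toℕ<n (hi v)) (toℕ<n (hi u))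
    (λ i i<n → trans (sym (bit-hi v i)) (trans (same i i<n) (bit-hi u i))))

  pairedAt-lo : ∀ u v → PairedAt (toℕ u) (toℕ v) 0 ≡ PairRel (bit₁ (lo u)) (bit₀ (lo u)) (bit₁ (lo v)) (bit₀ (lo v))
  pairedAt-lo u v rewrite bit-lo₀ u | bit-lo₁ u | bit-lo₀ v | bit-lo₁ v = refl

  pairedAt-hi : ∀ u v i → PairedAt (toℕ u) (toℕ v) (suc i) ≡ PairedAt (toℕ (hi u)) (toℕ (hi v)) i
  pairedAt-hi u v i = begin
    PairedAt (toℕ u) (toℕ v) (suc i)
      ≡⟨ cong (λ j → PairRel (bit (toℕ u) (suc j)) (bit (toℕ u) j) (bit (toℕ v) (suc j)) (bit (toℕ v) j)) (*-suc 2 i) ⟩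
    PairRel (bit (toℕ u) (2 + suc (2 * i))) (bit (toℕ u) (2 + 2 * i)) (bit (toℕ v) (2 + suc (2 * i))) (bit (toℕ v) (2 + 2 * i))
      ≡⟨ PairRel-cong (bit-hi u (suc (2 * i))) (bit-hi u (2 * i)) (bit-hi v (suc (2 * i))) (bit-hi v (2 * i)) ⟩
    PairedAt (toℕ (hi u)) (toℕ (hi v)) i ∎
    where open ≡-Reasoning

  data Step (p : Low) (y : Vertex n) (q : Low) (y′ : Vertex n) : Set where
    step₀ : q ≡ flip₀ p → y′ ≡ y → Step p y q y′
    step₁ : q ≡ flip₁ p → y′ ≡ y → Step p y q y′
    cross : q ≡ partner p → Adj n y y′ → Step p y q y′

  Link : V → V → Set
  Link u v = Step (lo u) (hi u) (lo v) (hi v)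

  link⇒adj : ∀ {u v} → Link u v → Adj (n + 2) u v
  link⇒adj {u} {v} (step₀ l h) = 0 , m<2⇒m<n+2 n z<s , differ , (λ ()) , above , (λ _ ())
    where
    differ : bit (toℕ v) 0 ≢ bit (toℕ u) 0
    differ e = bit₀-flip₀ (lo u) (trans (cong bit₀ (sym l)) (trans (sym (bit-lo₀ v)) (trans e (bit-lo₀ u))))
    above : ∀ i → 0 < i → i < n + 2 → bit (toℕ v) i ≡ bit (toℕ u) i
    above 1 _ _ = trans (bit-lo₁ v) (trans (cong bit₁ l) (trans (bit₁-flip₀ (lo u)) (sym (bit-lo₁ u))))
    above (suc (suc i)) _ _ = high-bits-agree {u} {v} h i
  link⇒adj {u} {v} (step₁ l h) = 1 , m<2⇒m<n+2 n (s≤s z<s) , differ , (λ _ → same₀) , above , (λ _ ())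
    where
    differ : bit (toℕ v) 1 ≢ bit (toℕ u) 1
    differ e = bit₁-flip₁ (lo u) (trans (cong bit₁ (sym l)) (trans (sym (bit-lo₁ v)) (trans e (bit-lo₁ u))))
    same₀ : bit (toℕ v) 0 ≡ bit (toℕ u) 0
    same₀ = trans (bit-lo₀ v) (trans (cong bit₀ l) (trans (bit₀-flip₁ (lo u)) (sym (bit-lo₀ u))))
    above : ∀ i → 1 < i → i < n + 2 → bit (toℕ v) i ≡ bit (toℕ u) i
    above 1 (s≤s ()) _
    above (suc (suc i)) _ _ = high-bits-agree {u} {v} h i
  link⇒adj {u} {v} (cross l (x , x<n , differ , parity , above , paired)) =
    2 + x , m<n⇒2+m<n+2 x<n , differ′ , parity′ x parity , above′ , paired′
    where
    differ′ : bit (toℕ v) (2 + x) ≢ bit (toℕ u) (2 + x)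
    differ′ e = differ (trans (sym (bit-hi v x)) (trans e (bit-hi u x)))
    parity′ : ∀ x → (x % 2 ≡ 1 → bit (toℕ (hi v)) (x ∸ 1) ≡ bit (toℕ (hi u)) (x ∸ 1))
            → (2 + x) % 2 ≡ 1 → bit (toℕ v) (suc x) ≡ bit (toℕ u) (suc x)
    parity′ (suc x) par e = trans (bit-hi v x) (trans (par e) (sym (bit-hi u x)))
    above′ : ∀ i → 2 + x < i → i < n + 2 → bit (toℕ v) i ≡ bit (toℕ u) i
    above′ (suc (suc i)) (s≤s (s≤s x<i)) i< =
      trans (bit-hi v i) (trans (above i x<i (2+m<n+2⇒m<n i<)) (sym (bit-hi u i)))
    paired′ : ∀ i → i < (2 + x) / 2 → PairedAt (toℕ u) (toℕ v) i
    paired′ zero _ =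
      subst id (sym (pairedAt-lo u v)) (subst (λ q → PairRel _ _ (bit₁ q) (bit₀ q)) (sym l) (partner-paired (lo u)))
    paired′ (suc i) i< =
      subst id (sym (pairedAt-hi u v i)) (paired i (s<s⁻¹ (subst (suc i <_) ([2+m]/2≡1+m/2 x) i<)))

  adj⇒link : ∀ {u v} → Adj (n + 2) u v → Link u v
  adj⇒link {u} {v} (0 , _ , differ , _ , above , _) =
    step₀ (flip₀-unique (lo u) (lo v) differ₀ same₁) (hi-from-bits {u} {v} (λ i i<n → above (2 + i) z<s (m<n⇒2+m<n+2 i<n)))
    where
    differ₀ : bit₀ (lo v) ≢ bit₀ (lo u)
    differ₀ e = differ (trans (bit-lo₀ v) (trans e (sym (bit-lo₀ u))))
    same₁ : bit₁ (lo v) ≡ bit₁ (lo u)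
    same₁ = trans (sym (bit-lo₁ v)) (trans (above 1 z<s (m<2⇒m<n+2 n (s≤s z<s))) (bit-lo₁ u))
  adj⇒link {u} {v} (1 , _ , differ , parity , above , _) =
    step₁ (flip₁-unique (lo u) (lo v) differ₁ same₀) (hi-from-bits {u} {v} (λ i i<n → above (2 + i) (s<s z<s) (m<n⇒2+m<n+2 i<n)))
    where
    differ₁ : bit₁ (lo v) ≢ bit₁ (lo u)
    differ₁ e = differ (trans (bit-lo₁ v) (trans e (sym (bit-lo₁ u))))
    same₀ : bit₀ (lo v) ≡ bit₀ (lo u)
    same₀ = trans (sym (bit-lo₀ v)) (trans (parity refl) (bit-lo₀ u))
  adj⇒link {u} {v} (suc (suc x) , x< , differ , parity , above , paired) =
    cross (partner-unique (lo u) (lo v) paired-lo) (x , 2+m<n+2⇒m<n x< , differ′ , parity′ x parity , above′ , paired′)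
    where
    paired-lo : PairRel (bit₁ (lo u)) (bit₀ (lo u)) (bit₁ (lo v)) (bit₀ (lo v))
    paired-lo = subst id (pairedAt-lo u v) (paired 0 (subst (0 <_) (sym ([2+m]/2≡1+m/2 x)) z<s))
    differ′ : bit (toℕ (hi v)) x ≢ bit (toℕ (hi u)) x
    differ′ e = differ (trans (bit-hi v x) (trans e (sym (bit-hi u x))))
    parity′ : ∀ x → ((2 + x) % 2 ≡ 1 → bit (toℕ v) (suc x) ≡ bit (toℕ u) (suc x))
            → x % 2 ≡ 1 → bit (toℕ (hi v)) (x ∸ 1) ≡ bit (toℕ (hi u)) (x ∸ 1)
    parity′ (suc x) par e = trans (sym (bit-hi v x)) (trans (par e) (bit-hi u x))
    above′ : ∀ i → x < i → i < n → bit (toℕ (hi v)) i ≡ bit (toℕ (hi u)) i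
    above′ i x<i i<n = trans (sym (bit-hi v i)) (trans (above (2 + i) (s<s (s<s x<i)) (m<n⇒2+m<n+2 i<n)) (bit-hi u i))
    paired′ : ∀ i → i < x / 2 → PairedAt (toℕ (hi u)) (toℕ (hi v)) i
    paired′ i i< = subst id (pairedAt-hi u v i) (paired (suc i) (subst (suc i <_) (sym ([2+m]/2≡1+m/2 x)) (s≤s i<)))

  join-adj : ∀ p y q y′ → Step p y q y′ → Adj (n + 2) (join p y) (join q y′)
  join-adj p y q y′ s = link⇒adj
    (subst₂ (λ a b → Step a b (lo (join q y′)) (hi (join q y′))) (sym (lo-join p y)) (sym (hi-join p y))
      (subst₂ (Step p y) (sym (lo-join q y′)) (sym (hi-join q y′)) s))

  join-≢ˡ : ∀ {p q} y y′ → p ≢ q → join p y ≢ join q y′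
  join-≢ˡ {p} {q} y y′ p≢q e = p≢q (trans (sym (lo-join p y)) (trans (cong lo e) (lo-join q y′)))

  join-≢ʳ : ∀ p q {y y′} → y ≢ y′ → join p y ≢ join q y′
  join-≢ʳ p q {y} {y′} y≢y′ e = y≢y′ (trans (sym (hi-join p y)) (trans (cong hi e) (hi-join q y′)))

  transport-link : ∀ (P : V → V → Set) {u v q y′} → lo v ≡ q → hi v ≡ y′ → P (join (lo u) (hi u)) (join q y′) → P u v
  transport-link P {u} {v} l h = subst₂ P (join-lo-hi u) (trans (cong₂ join (sym l) (sym h)) (join-lo-hi v))

  block-square : ∀ p y → Square (Adj (n + 2)) (join p y) (join (flip₀ p) y) (join (flip₁ (flip₀ p)) y) (join (flip₁ p) y)
  block-square p y =
    join-adj p y (flip₀ p) y (step₀ refl refl) ,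
    join-adj (flip₀ p) y (flip₁ (flip₀ p)) y (step₁ refl refl) ,
    join-adj (flip₁ (flip₀ p)) y (flip₁ p) y (step₀ closes refl) ,
    join-adj (flip₁ p) y p y (step₁ (sym (flip₁-involutive p)) refl) ,
    join-≢ˡ y y (flip₁-flip₀≢id p ∘ sym) ,
    join-≢ˡ y y (flip₀≢flip₁ p)
    where
    closes : flip₁ p ≡ flip₀ (flip₁ (flip₀ p))
    closes = sym (trans (flip₀-flip₁-comm (flip₀ p)) (cong flip₁ (flip₀-involutive p)))

  cross-square : ∀ p {y y′} → Adj n y y′ →
    Square (Adj (n + 2)) (join p y) (join (partner p) y′) (join (flip₁ (partner p)) y′) (join (flip₁ p) y)
  cross-square p {y} {y′} yy′ =
    join-adj p y (partner p) y′ (cross refl yy′) ,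
    join-adj (partner p) y′ (flip₁ (partner p)) y′ (step₁ refl refl) ,
    join-adj (flip₁ (partner p)) y′ (flip₁ p) y (cross closes (Adj-sym yy′)) ,
    join-adj (flip₁ p) y p y (step₁ (sym (flip₁-involutive p)) refl) ,
    join-≢ʳ p (flip₁ (partner p)) (Adj⇒≢ yy′) ,
    join-≢ʳ (partner p) (flip₁ p) (Adj⇒≢ yy′ ∘ sym)
    where
    closes : flip₁ p ≡ partner (flip₁ (partner p))
    closes = sym (trans (partner-flip₁-comm (partner p)) (cong flip₁ (partner-involutive p)))

  square-lift : ∀ p {y y′ y₂ y₃} → Square (Adj n) y y′ y₂ y₃ →
    Square (Adj (n + 2)) (join p y) (join (partner p) y′) (join p y₂) (join (partner p) y₃)
  square-lift p {y} {y′} {y₂} {y₃} (yy′ , y′y₂ , y₂y₃ , y₃y , y≢y₂ , y′≢y₃) =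
    join-adj p y (partner p) y′ (cross refl yy′) ,
    join-adj (partner p) y′ p y₂ (cross (sym (partner-involutive p)) y′y₂) ,
    join-adj p y₂ (partner p) y₃ (cross refl y₂y₃) ,
    join-adj (partner p) y₃ p y (cross (sym (partner-involutive p)) y₃y) ,
    join-≢ʳ p p y≢y₂ ,
    join-≢ʳ (partner p) (partner p) y′≢y₃

  hasNeighbours : HasNeighbours (n + 2)
  hasNeighbours u = w , subst (λ a → Adj (n + 2) a w) (join-lo-hi u) (join-adj (lo u) (hi u) (flip₀ (lo u)) (hi u) (step₀ refl refl))
    where w = join (flip₀ (lo u)) (hi u)

  edgesOnSquares : EdgesOnSquares (n + 2)
  edgesOnSquares {u} {v} uv with adj⇒link uv
  ... | step₀ l h = transport-link (OnSquare (Adj (n + 2))) l h (_ , _ , block-square (lo u) (hi u))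
  ... | step₁ l h = transport-link (OnSquare (Adj (n + 2))) l h (_ , _ , square-reverse (Adj (n + 2)) Adj-sym (block-square (lo u) (hi u)))
  ... | cross l yy′ = transport-link (OnSquare (Adj (n + 2))) l refl (_ , _ , cross-square (lo u) yy′)

  Flip₀ Flip₁ : V → V → Set
  Flip₀ u v = lo v ≡ flip₀ (lo u) × hi v ≡ hi u
  Flip₁ u v = lo v ≡ flip₁ (lo u) × hi v ≡ hi u

  flip₀-square⇒flip₁ : ∀ {u v w z} → Flip₀ u v → Square (Adj (n + 2)) u v w z → Flip₁ v w
  flip₀-square⇒flip₁ {u} {v} {w} {z} (lv , hv) (_ , vw , wz , zu , u≢w , v≢z) with adj⇒link vw
  ... | step₀ lw hw = ⊥-elim (u≢w (lo-hi-injective (sym (trans lw (trans (cong flip₀ lv) (flip₀-involutive (lo u)))))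
                                                   (sym (trans hw hv))))
  ... | step₁ lw hw = lw , hw
  ... | cross lw hi-adj with adj⇒link zu
  ...   | step₀ lu hu = ⊥-elim (v≢z (lo-hi-injective (trans lv (trans (cong flip₀ lu) (flip₀-involutive (lo z))))
                                                    (trans hv hu)))
  ...   | step₁ lu hu with adj⇒link wz
  ...     | step₀ _ hz = ⊥-elim (Adj⇒≢ hi-adj (trans hv (trans hu hz)))
  ...     | step₁ _ hz = ⊥-elim (Adj⇒≢ hi-adj (trans hv (trans hu hz)))
  ...     | cross lz _ = ⊥-elim (flip₀-partner-partner-flip₁-not-closed (lo u)
                           (sym (trans lu (cong flip₁ (trans lz (cong partner (trans lw (cong partner lv))))))))
  flip₀-square⇒flip₁ {u} (lv , _) (_ , _ , wz , _) | cross lw _ | cross lu _ with adj⇒link wz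
  ...     | step₀ lz _ = ⊥-elim (flip₀-partner-flip₀-partner-not-closed (lo u)
                           (sym (trans lu (cong partner (trans lz (cong flip₀ (trans lw (cong partner lv))))))))
  ...     | step₁ lz _ = ⊥-elim (flip₀-partner-flip₁-partner-not-closed (lo u)
                           (sym (trans lu (cong partner (trans lz (cong flip₁ (trans lw (cong partner lv))))))))
  ...     | cross lz _ = ⊥-elim (flip₀-partner-partner-partner-not-closed (lo u)
                           (sym (trans lu (cong partner (trans lz (cong partner (trans lw (cong partner lv))))))))

  flip₀-not-onTwoSquares : ∀ {u v} → Flip₀ u v → ¬ OnTwoSquares (Adj (n + 2)) u v
  flip₀-not-onTwoSquares f (w , z , w′ , z′ , sq , sq′ , w≢w′) with flip₀-square⇒flip₁ f sq | flip₀-square⇒flip₁ f sq′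
  ... | lw , hw | lw′ , hw′ = w≢w′ (lo-hi-injective (trans lw (sym lw′)) (trans hw (sym hw′)))

  flip₁-onTwoSquares : HasNeighbours n → ∀ p y → OnTwoSquares (Adj (n + 2)) (join p y) (join (flip₁ p) y)
  flip₁-onTwoSquares neighbour p y =
    _ , _ , _ , _ ,
    square-reverse (Adj (n + 2)) Adj-sym (block-square p y) ,
    square-reverse (Adj (n + 2)) Adj-sym (cross-square p yy₁) ,
    join-≢ʳ (flip₁ (flip₀ p)) (flip₁ (partner p)) (Adj⇒≢ yy₁)
    where yy₁ = proj₂ (neighbour y)

  cross-onTwoSquares : EdgesOnSquares n → ∀ p {y y′} → Adj n y y′ →
    OnTwoSquares (Adj (n + 2)) (join p y) (join (partner p) y′)
  cross-onTwoSquares onSquare p yy′ with onSquare yy′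
  ... | _ , _ , sq@(_ , y′y₂ , _) =
    _ , _ , _ , _ , cross-square p yy′ , square-lift p sq , join-≢ʳ (flip₁ (partner p)) p (Adj⇒≢ y′y₂)

  flip₀-or-onTwoSquares : HasNeighbours n → EdgesOnSquares n →
    ∀ {u v} → Adj (n + 2) u v → Flip₀ u v ⊎ OnTwoSquares (Adj (n + 2)) u v
  flip₀-or-onTwoSquares neighbour onSquare {u} uv with adj⇒link uv
  ... | step₀ l h = inj₁ (l , h)
  ... | step₁ l h = inj₂ (transport-link (OnTwoSquares (Adj (n + 2))) l h (flip₁-onTwoSquares neighbour (lo u) (hi u)))
  ... | cross l yy′ = inj₂ (transport-link (OnTwoSquares (Adj (n + 2))) l refl (cross-onTwoSquares onSquare (lo u) yy′))

  BlockPreserving : (V → V) → Set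
  BlockPreserving f = ∀ {u v} → hi u ≡ hi v → hi (f u) ≡ hi (f v)

  module _ (neighbour : HasNeighbours n) (onSquare : EdgesOnSquares n) {φ} (aut : IsAutomorphism (n + 2) φ) where

    flip₀-preserved : ∀ {u v} → Flip₀ u v → Flip₀ (φ u) (φ v)
    flip₀-preserved f@(l , h) with flip₀-or-onTwoSquares neighbour onSquare (preserves-adj aut (link⇒adj (step₀ l h)))
    ... | inj₁ f′ = f′
    ... | inj₂ t = ⊥-elim (flip₀-not-onTwoSquares f (onTwoSquares-reflect aut t))

    flip₁-preserved : ∀ {u v} → Flip₁ u v → Flip₁ (φ u) (φ v)
    flip₁-preserved {u} {v} (l , h) =
      flip₀-square⇒flip₁ (flip₀-preserved a-u) (square-map (Adj (n + 2)) (preserves-adj aut) (proj₁ (proj₁ aut)) sq)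
      where
      a = join (flip₀ (lo u)) (hi u)
      b = join (flip₁ (flip₀ (lo u))) (hi u)
      a-u : Flip₀ a u
      a-u = sym (trans (cong flip₀ (lo-join (flip₀ (lo u)) (hi u))) (flip₀-involutive (lo u))) , sym (hi-join (flip₀ (lo u)) (hi u))
      sq : Square (Adj (n + 2)) a u v b
      sq = transport-link (λ u′ v′ → Square (Adj (n + 2)) a u′ v′ b) l h
             (square-rotate (Adj (n + 2)) (square-reverse (Adj (n + 2)) Adj-sym (block-square (lo u) (hi u))))

    block-preserved : BlockPreserving φ
    block-preserved {u} {v} h with within-block (lo u) (lo v)
    ... | inj₁ l = cong (hi ∘ φ) (lo-hi-injective (sym l) h)
    ... | inj₂ (inj₁ l) = sym (proj₂ (flip₀-preserved {u} {v} (l , sym h)))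
    ... | inj₂ (inj₂ (inj₁ l)) = sym (proj₂ (flip₁-preserved {u} {v} (l , sym h)))
    ... | inj₂ (inj₂ (inj₂ l)) = sym (trans (proj₂ (flip₁-preserved {a} {v} a-v)) (proj₂ (flip₀-preserved {u} {a} u-a)))
      where
      a = join (flip₀ (lo u)) (hi u)
      u-a : Flip₀ u a
      u-a = lo-join (flip₀ (lo u)) (hi u) , hi-join (flip₀ (lo u)) (hi u)
      a-v : Flip₁ a v
      a-v = trans l (cong flip₁ (sym (lo-join (flip₀ (lo u)) (hi u)))) , trans (sym h) (sym (hi-join (flip₀ (lo u)) (hi u)))

  times4≡join : ∀ y → times4 n y ≡ join l0 y
  times4≡join y = toℕ-injective (trans (toℕ-fromℕ< _) (trans (*-comm 4 (toℕ y)) (sym (toℕ-join l0 y))))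

  hi-times4 : ∀ y → hi (times4 n y) ≡ y
  hi-times4 y = trans (cong hi (times4≡join y)) (hi-join l0 y)

  times4-adj : ∀ {y y′} → Adj n y y′ → Adj (n + 2) (times4 n y) (times4 n y′)
  times4-adj {y} {y′} yy′ = subst₂ (Adj (n + 2)) (sym (times4≡join y)) (sym (times4≡join y′)) (join-adj l0 y l0 y′ (cross refl yy′))

  module _ (φ ψ : V → V) (ψ-blocks : BlockPreserving ψ) (ψφ : ∀ u → ψ (φ u) ≡ u) where

    block-reflected : ∀ {u v} → hi (φ u) ≡ hi (φ v) → hi u ≡ hi v
    block-reflected {u} {v} h = subst₂ (λ a b → hi a ≡ hi b) (ψφ u) (ψφ v) (ψ-blocks h)

    hat-inverse : ∀ y → hat n ψ (hat n φ y) ≡ y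
    hat-inverse y = begin
      hi (ψ (times4 n (hi x))) ≡⟨ ψ-blocks (hi-times4 (hi x)) ⟩
      hi (ψ x)                 ≡⟨ cong hi (ψφ (times4 n y)) ⟩
      hi (times4 n y)          ≡⟨ hi-times4 y ⟩
      y                        ∎
      where
      open ≡-Reasoning
      x = φ (times4 n y)

    hat-injective : ∀ {y y′} → hat n φ y ≡ hat n φ y′ → y ≡ y′
    hat-injective {y} {y′} h = trans (sym (hi-times4 y)) (trans (block-reflected h) (hi-times4 y′))

    hat-preserves-adj : IsAutomorphism (n + 2) φ → ∀ {y y′} → Adj n y y′ → Adj n (hat n φ y) (hat n φ y′)
    hat-preserves-adj aut {y} {y′} yy′ with adj⇒link (preserves-adj aut (times4-adj yy′))
    ... | step₀ _ h = ⊥-elim (Adj⇒≢ yy′ (hat-injective (sym h)))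
    ... | step₁ _ h = ⊥-elim (Adj⇒≢ yy′ (hat-injective (sym h)))
    ... | cross _ a = a

  hat-isAutomorphism : HasNeighbours n → EdgesOnSquares n →
    ∀ {φ} → IsAutomorphism (n + 2) φ → IsAutomorphism n (hat n φ)
  hat-isAutomorphism neighbour onSquare {φ} aut =
    strictlyInverseᵇ⇒bijective (hat n ψ) (hat-inverse ψ φ φ-blocks (inverseˡ aut)) (hat-inverse φ ψ ψ-blocks (inverseʳ aut)) ,
    λ y y′ → mk⇔ (hat-preserves-adj φ ψ ψ-blocks (inverseʳ aut) aut)
                 (subst₂ (Adj n) (hat-inverse φ ψ ψ-blocks (inverseʳ aut) y) (hat-inverse φ ψ ψ-blocks (inverseʳ aut) y′)
                  ∘ hat-preserves-adj ψ φ φ-blocks (inverseˡ aut) ψ-aut)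
    where
    ψ = inverse aut
    ψ-aut = inverse-isAutomorphism aut
    φ-blocks = block-preserved neighbour onSquare aut
    ψ-blocks = block-preserved neighbour onSquare ψ-aut

lemma15 : (n : ℕ) → 5 ≤ n → (φ : Vertex (n + 2) → Vertex (n + 2))
    → IsAutomorphism (n + 2) φ → IsAutomorphism n (hat n φ)
lemma15 (suc zero) (s≤s ())
lemma15 (suc (suc k)) _ φ =
  hat-isAutomorphism (2 + k) (subst HasNeighbours (+-comm k 2) (hasNeighbours k))
                             (subst EdgesOnSquares (+-comm k 2) (edgesOnSquares k))
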